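{- Let $(C,\phi)$ be a multistate monotone system and $k\in\{1,\ldots,M\}$. If $(C,\phi_k)$ is not strongly coherent, then $d(\phi_k)=0$.
   Context: A multistate monotone system (MMS) $(C,\phi)$ has component set $C=\{1,\ldots,n\}$, component state sets $\mathcal{S}_i=\{0,1,\ldots,m_i\}$, component state space $\mathfrak{C}=\mathcal{S}_1\times\cdots\times\mathcal{S}_n$, system state set $\{0,1,\ldots,M\}$, and a structure function $\phi:\mathfrak{C}\to\{0,\ldots,M\}$ non-decreasing in each argument; $\phi_k(\bm{x})=\mathrm{I}(\phi(\bm{x})\ge k)$. Vectors are ordered componentwise. A minimal $k$-level path vector is $\bm{x}\in\mathfrak{C}$ with $\phi(\bm{x})\ge k$ and $\phi(\bm{y})<k$ for all $\bm{y}\le\bm{x}$, $\bm{y}\ne\bm{x}$; $\mathfrak{P}_k$ is the set of these. $\mathrm{cl}(\mathfrak{P}_k)$ is the smallest set containing $\mathfrak{P}_k$ closed under componentwise maximum $\vee$. A formation of $\bm{x}\in\mathrm{cl}(\mathfrak{P}_k)$ is a nonempty subset $\{\bm{x}_{i_1},\ldots,\bm{x}_{i_j}\}\subseteq\mathfrak{P}_k$ with $\bm{x}=\bm{x}_{i_1}\vee\cdots\vee\bm{x}_{i_j}$, odd/even according to parity of $j$. The $k$-level signed domination function $\delta_k(\bm{x})$ is (number of odd formations) $-$ (number of even formations) for $\bm{x}\in\mathrm{cl}(\mathfrak{P}_k)$, and $\delta_k(\bm{x})=0$ for $\bm{x}\in\mathfrak{C}\setminus\mathrm{cl}(\mathfrak{P}_k)$.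 The signed domination of $\phi_k$ is $d(\phi_k)=\delta_k(\bm{m})$, where $\bm{m}=(m_1,\ldots,m_n)$. Component $i$ is strongly relevant with respect to $\phi_k$ if some $\bm{x}\in\mathfrak{P}_k$ has $x_i=m_i$; $(C,\phi_k)$ is strongly coherent if all components are strongly relevant with respect to $\phi_k$. -}

module Defs where

open import Data.Nat as ℕ using (ℕ; zero; suc)
open import Data.Fin as Fin using (Fin; toℕ; fromℕ; _≟_)
open import Data.Fin.Properties using (all?)
open import Data.Integer as ℤ using (ℤ; +_; _-_)
open import Data.List using (List; allFin; []; _∷_; [_]; _++_; map; concatMap; filter; length; foldr)
open import Data.List.Relation.Unary.All as All using (All)
open import Data.Product using (Σ; _×_; _,_)
open import Relation.Binary.PropositionalEquality using (_≡_)
open import Relation.Nullary using (¬_; Dec; yes; no)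
open import Relation.Nullary.Decidable using (_×-dec_; _→-dec_; ¬?)
open import Data.Nat.DivMod using (_%_)
open import Data.Bool using (if_then_else_)
open import Relation.Nullary.Decidable using (does)

State : (n : ℕ) → (Fin n → ℕ) → Set
State n m = (i : Fin n) → Fin (suc (m i))

module _ {n : ℕ} {m : Fin n → ℕ} where

  _≤ˢ_ : State n m → State n m → Set
  x ≤ˢ y = ∀ i → x i Fin.≤ y i

  _≐_ : State n m → State n m → Set
  x ≐ y = ∀ i → x i ≡ y i

  _≤ˢ?_ : ∀ x y → Dec (x ≤ˢ y)
  x ≤ˢ? y = all? (λ i → x i Fin.≤? y i)

  _≐?_ : ∀ x y → Dec (x ≐ y)
  x ≐? y = all? (λ i → x i ≟ y i)

  _∨_ : State n m → State n m → State n m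
  (x ∨ y) i = if does (x i Fin.≤? y i) then y i else x i

  bottom : State n m
  bottom i = Fin.zero

  top : State n m
  top i = fromℕ (m i)

  ⋁ : List (State n m) → State n m
  ⋁ = foldr _∨_ bottom

allStates : (n : ℕ) (m : Fin n → ℕ) → List (State n m)
allStates zero m = [ (λ ()) ]
allStates (suc n) m =
  concatMap (λ a → map (cons a) (allStates n (λ i → m (Fin.suc i))))
            (allFin (suc (m Fin.zero)))
  where
  cons : Fin (suc (m Fin.zero)) → State n (λ i → m (Fin.suc i)) → State (suc n) m
  cons a f Fin.zero = a
  cons a f (Fin.suc i) = f i

sublists : {A : Set} → List A → List (List A)
sublists [] = [ [] ]
sublists (x ∷ xs) = sublists xs ++ map (x ∷_) (sublists xs)

record MMS : Set where
  field
    n : ℕ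
    m : Fin n → ℕ
    M : ℕ
    φ : State n m → Fin (suc M)
    monotone : ∀ x y → x ≤ˢ y → toℕ (φ x) ℕ.≤ toℕ (φ y)

module _ (S : MMS) where
  open MMS S

  IsMinPath : ℕ → State n m → Set
  IsMinPath k x = k ℕ.≤ toℕ (φ x)
                × (∀ y → y ≤ˢ x → ¬ (y ≐ x) → toℕ (φ y) ℕ.< k)

  isMinPath? : ∀ k x → Dec (k ℕ.≤ toℕ (φ x)
                 × All (λ y → y ≤ˢ x → ¬ (y ≐ x) → toℕ (φ y) ℕ.< k) (allStates n m))
  isMinPath? k x = (k ℕ.≤? toℕ (φ x)) ×-dec
    All.all? (λ y → (y ≤ˢ? x) →-dec (¬? (y ≐? x) →-dec (suc (toℕ (φ y)) ℕ.≤? k)))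
      (allStates n m)

  -- 𝔓_k as a (duplicate-free) list
  minPaths : ℕ → List (State n m)
  minPaths k = filter (isMinPath? k) (allStates n m)

  -- formations of x: nonempty subsets of 𝔓_k whose join is x
  IsOddFormation IsEvenFormation : State n m → List (State n m) → Set
  IsOddFormation x F = length F % 2 ≡ 1 × (⋁ F ≐ x)
  IsEvenFormation x F = (length F % 2 ≡ 0 × ¬ (length F ≡ 0)) × (⋁ F ≐ x)

  -- k-level signed domination function: #odd formations − #even formations
  -- (0 automatically when x ∉ cl(𝔓_k), since then there are no formations)
  δ : ℕ → State n m → ℤ
  δ k x = + length (filter (λ F → (length F % 2 ℕ.≟ 1) ×-dec (⋁ F ≐? x)) (sublists (minPaths k)))
        - + length (filter (λ F → ((length F % 2 ℕ.≟ 0) ×-dec ¬? (length F ℕ.≟ 0)) ×-dec (⋁ F ≐? x))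
                           (sublists (minPaths k)))

  d : ℕ → ℤ
  d k = δ k top

  StronglyRelevant : ℕ → Fin n → Set
  StronglyRelevant k i = Σ (State n m) λ x → IsMinPath k x × toℕ (x i) ≡ m i

  StronglyCoherent : ℕ → Set
  StronglyCoherent k = ∀ i → StronglyRelevant k i

-- In every coordinate the join of a list of state vectors is 0 or the value of
-- one of its members. Hence if m has a formation, every component i reaches its
-- top state m_i in some minimal k-level path vector of that formation, i.e. φ_k
-- is strongly coherent. If it is not, m has no formations at all and both
-- counts in δ_k(m) are zero.
module Submission where

open import Defs
open import Data.Nat using (ℕ; _≤_)
open import Data.Integer using (0ℤ; +_; _-_)
open import Relation.Binary.PropositionalEquality using (_≡_)
open import Relation.Nullary using (¬_)

open import Data.Nat as ℕ using (zero; suc)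
open import Data.Nat.Properties using (n≤0⇒n≡0; ≤-<-trans; 0≢1+n)
open import Data.Fin as Fin using (Fin; toℕ)
open import Data.Fin.Properties using (toℕ-fromℕ; toℕ≤pred[n]; ≤-reflexive)
open import Data.List using (List; []; _∷_; length)
open import Data.List.Properties using (filter-none)
open import Data.List.Relation.Unary.All as All using (All)
open import Data.List.Relation.Unary.Any as Any using (Any; here; there)
open import Data.List.Relation.Unary.Any.Properties using (concatMap⁺; map⁺)
open import Data.List.Membership.Propositional using (_∈_; find)
open import Data.List.Membership.Propositional.Properties using (∈-map⁻; ∈-++⁻; ∈-filter⁻; ∈-allFin)
open import Data.List.Relation.Binary.Subset.Propositional using (_⊆_)
open import Data.Product using (_,_)
open import Data.Sum using (_⊎_; inj₁; inj₂)
open import Data.Bool using (true; false)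
open import Data.Empty using (⊥-elim)
open import Relation.Binary.PropositionalEquality using (refl; sym; trans; cong; cong₂; subst)
open import Relation.Nullary using (does)

∈-sublists⇒⊆ : {A : Set} (xs : List A) {F : List A} → F ∈ sublists xs → F ⊆ xs
∈-sublists⇒⊆ [] (here refl) ()
∈-sublists⇒⊆ (y ∷ xs) F∈ x∈F with ∈-++⁻ (sublists xs) F∈
... | inj₁ F∈′ = there (∈-sublists⇒⊆ xs F∈′ x∈F)
... | inj₂ yG∈ with ∈-map⁻ (y ∷_) yG∈
...   | G , G∈ , refl with x∈F
...     | here x≡y  = here x≡y
...     | there x∈G = there (∈-sublists⇒⊆ xs G∈ x∈G)

odd⇒nonempty : {A : Set} (F : List A) → length F ℕ.% 2 ≡ 1 → ¬ length F ≡ 0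
odd⇒nonempty F odd empty = 0≢1+n (subst (λ l → l ℕ.% 2 ≡ 1) empty odd)

allStates-complete : ∀ n (m : Fin n → ℕ) (y : State n m) → Any (_≐ y) (allStates n m)
allStates-complete zero    m y = here (λ ())
allStates-complete (suc n) m y =
  concatMap⁺ _ (Any.map (λ { refl → map⁺ (Any.map (λ z≐tail → λ { Fin.zero → refl ; (Fin.suc i) → z≐tail i })
                                                  tail∈) })
                        (∈-allFin (y Fin.zero)))
  where
  tail∈ : Any (_≐ (λ i → y (Fin.suc i))) (allStates n (λ i → m (Fin.suc i)))
  tail∈ = allStates-complete n (λ i → m (Fin.suc i)) (λ i → y (Fin.suc i))

module _ {n : ℕ} {m : Fin n → ℕ} where

  ≐⇒≤ˢ : {x y : State n m} → x ≐ y → x ≤ˢ y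
  ≐⇒≤ˢ x≐y i = ≤-reflexive (x≐y i)

  ∨-selective : (x y : State n m) (i : Fin n) → (x ∨ y) i ≡ x i ⊎ (x ∨ y) i ≡ y i
  ∨-selective x y i with does (x i Fin.≤? y i)
  ... | true  = inj₂ refl
  ... | false = inj₁ refl

  ⋁-selective : (F : List (State n m)) (i : Fin n) →
                ⋁ F i ≡ Fin.zero ⊎ Any (λ x → ⋁ F i ≡ x i) F
  ⋁-selective []      i = inj₁ refl
  ⋁-selective (x ∷ F) i with ∨-selective x (⋁ F) i | ⋁-selective F i
  ... | inj₁ ≡x  | _          = inj₂ (here ≡x)
  ... | inj₂ ≡⋁F | inj₁ ⋁F≡0  = inj₁ (trans ≡⋁F ⋁F≡0)
  ... | inj₂ ≡⋁F | inj₂ ⋁F≡xᵢ = inj₂ (there (Any.map (trans ≡⋁F) ⋁F≡xᵢ))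

  ⋁≐top⇒top-attained : (F : List (State n m)) → ¬ length F ≡ 0 → ⋁ F ≐ top →
                       ∀ i → Any (λ x → toℕ (x i) ≡ m i) F
  ⋁≐top⇒top-attained []      F≢[] _    i = ⊥-elim (F≢[] refl)
  ⋁≐top⇒top-attained (x ∷ F) _    ⋁≐m i with ⋁-selective (x ∷ F) i
  ... | inj₂ ⋁≡ =
    Any.map (λ ⋁≡yᵢ → trans (cong toℕ (trans (sym ⋁≡yᵢ) (⋁≐m i))) (toℕ-fromℕ (m i))) ⋁≡
  ... | inj₁ ⋁≡0 = here (trans (n≤0⇒n≡0 (subst (toℕ (x i) ≤_) mᵢ≡0 (toℕ≤pred[n] (x i)))) (sym mᵢ≡0))
    where
    -- the join is 0 in coordinate i while equal to m_i, so m_i = 0 and any member will do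
    mᵢ≡0 : m i ≡ 0
    mᵢ≡0 = trans (sym (toℕ-fromℕ (m i))) (cong toℕ (trans (sym (⋁≐m i)) ⋁≡0))

module _ (S : MMS) where
  open MMS S

  ∈-minPaths⇒IsMinPath : ∀ k {x} → x ∈ minPaths S k → IsMinPath S k x
  ∈-minPaths⇒IsMinPath k {x} x∈ with ∈-filter⁻ (isMinPath? S k) {xs = allStates n m} x∈
  ... | _ , k≤φx , belowₗ = k≤φx , below
    where
    -- the decision procedure only quantifies over the enumerated vectors:
    -- pass from y to its pointwise-equal copy in allStates
    below : ∀ y → y ≤ˢ x → ¬ (y ≐ x) → toℕ (φ y) ℕ.< k
    below y y≤x y≢x with find (allStates-complete n m y)
    ... | z , z∈ , z≐y =
      ≤-<-trans (monotone y z (≐⇒≤ˢ (λ i → sym (z≐y i))))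
        (All.lookup belowₗ z∈ (λ i → subst (Fin._≤ x i) (sym (z≐y i)) (y≤x i))
                              (λ z≐x → y≢x (λ i → trans (sym (z≐y i)) (z≐x i))))

  nonempty-join-top⇒StronglyCoherent : ∀ k {F} → F ∈ sublists (minPaths S k) →
    ¬ length F ≡ 0 → ⋁ F ≐ top → StronglyCoherent S k
  nonempty-join-top⇒StronglyCoherent k F∈ F≢[] ⋁≐m i
    with find (⋁≐top⇒top-attained _ F≢[] ⋁≐m i)
  ... | x , x∈F , xᵢ≡mᵢ =
    x , ∈-minPaths⇒IsMinPath k (∈-sublists⇒⊆ (minPaths S k) F∈ x∈F) , xᵢ≡mᵢ

  ¬StronglyCoherent⇒¬IsOddFormation : ∀ k → ¬ StronglyCoherent S k →
    ∀ {F} → F ∈ sublists (minPaths S k) → ¬ IsOddFormation S top F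
  ¬StronglyCoherent⇒¬IsOddFormation k incoherent {F} F∈ (odd , ⋁≐m) =
    incoherent (nonempty-join-top⇒StronglyCoherent k F∈ (odd⇒nonempty F odd) ⋁≐m)

  ¬StronglyCoherent⇒¬IsEvenFormation : ∀ k → ¬ StronglyCoherent S k →
    ∀ {F} → F ∈ sublists (minPaths S k) → ¬ IsEvenFormation S top F
  ¬StronglyCoherent⇒¬IsEvenFormation k incoherent F∈ ((_ , F≢[]) , ⋁≐m) =
    incoherent (nonempty-join-top⇒StronglyCoherent k F∈ F≢[] ⋁≐m)

proposition3p4 : (S : MMS) (k : ℕ) → 1 ≤ k → k ≤ MMS.M S →
    ¬ StronglyCoherent S k → d S k ≡ 0ℤ
proposition3p4 S k _ _ incoherent =
  cong₂ (λ odd even → + length odd - + length even)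
    (filter-none _ (All.tabulate (¬StronglyCoherent⇒¬IsOddFormation S k incoherent)))
    (filter-none _ (All.tabulate (¬StronglyCoherent⇒¬IsEvenFormation S k incoherent)))
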